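{- Let $n \geq 1$ and $k \geq 3$ be integers. If the hypercube $Q_n$ has a $C_k$-decomposition, then $Q_{2n}$ has an $L_{2k}$-decomposition.
   Context: For a positive integer $d$, the hypercube $Q_d$ is the graph whose vertices are the binary strings of length $d$, two vertices being adjacent if and only if they differ in exactly one position. $C_k$ denotes the cycle of length $k$. The sunlet graph $L_{2k}$ is the graph obtained from $C_k$ by attaching one pendant edge (to a new vertex) at each vertex of the cycle. For a graph $H$, an $H$-decomposition of a graph $G$ is a collection of edge-disjoint subgraphs of $G$, each isomorphic to $H$, whose edge sets partition $E(G)$. -}

module Defs where

open import Data.Nat using (ℕ; suc)
open import Data.Bool using (Bool)
open import Data.Fin using (Fin; zero; suc; toℕ; fromℕ<)
open import Data.Nat.DivMod using (_mod_)
open import Data.Vec using (Vec; lookup)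
open import Data.Product using (Σ; _×_; _,_; proj₁; proj₂)
open import Data.Sum using (_⊎_; inj₁; inj₂)
open import Relation.Binary.PropositionalEquality using (_≡_; _≢_)
open import Function.Definitions using (Injective)

record Graph : Set₁ where
  field
    V   : Set
    Adj : V → V → Set
open Graph public

-- A finite "pattern" graph given by a vertex type and an indexed list of
-- its edges (each edge listed exactly once, as an ordered pair of endpoints).
record Pattern : Set₁ where
  field
    PV  : Set
    nE  : ℕ
    end : Fin nE → PV × PV
open Pattern public

Q : ℕ → Graph
Q d = record
  { V   = Vec Bool d
  ; Adj = λ u v → Σ (Fin d) λ i →
            (lookup u i ≢ lookup v i) × (∀ j → j ≢ i → lookup u j ≡ lookup v j) }

next : ∀ {k} → Fin k → Fin k
next {suc k} i = Data.Fin.fromℕ< (Data.Nat.DivMod.m%n<n (suc (toℕ i)) (suc k))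
  where import Data.Nat.DivMod

C : ℕ → Pattern
C k = record { PV = Fin k ; nE = k ; end = λ i → (i , next i) }

-- Sunlet L_{2k}: cycle vertices inj₁ i, pendant vertices inj₂ i;
-- edges: cycle edges (indices inj₁ i) and pendant edges {inj₁ i, inj₂ i}.
L : ℕ → Pattern
L k = record
  { PV  = Fin k ⊎ Fin k
  ; nE  = k Data.Nat.+ k
  ; end = λ e → sunletEdge (Data.Fin.splitAt k e) }
  where
  import Data.Nat
  sunletEdge : Fin k ⊎ Fin k → (Fin k ⊎ Fin k) × (Fin k ⊎ Fin k)
  sunletEdge (inj₁ i) = inj₁ i , inj₁ (next i)
  sunletEdge (inj₂ i) = inj₁ i , inj₂ i

-- The image of the (ordered) pattern edge (a , b) under φ is the
-- unordered edge {u , v}.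
_↦_≈_ : {A B : Set} → (A → B) → A × A → B × B → Set
φ ↦ (a , b) ≈ (u , v) = (φ a ≡ u × φ b ≡ v) ⊎ (φ a ≡ v × φ b ≡ u)

-- An H-decomposition of G: finitely many copies of H in G, each given by an
-- injective edge-preserving map φ c : PV H → V G (its image is a subgraph of
-- G isomorphic to H), such that every edge of G is the image of exactly one
-- edge of exactly one copy (edge-disjoint and covering E(G)).
record Decomposition (H : Pattern) (G : Graph) : Set where
  field
    copies   : ℕ
    φ        : Fin copies → PV H → V G
    injφ     : ∀ c → Injective _≡_ _≡_ (φ c)
    edges    : ∀ c e → Adj G (φ c (proj₁ (end H e))) (φ c (proj₂ (end H e)))
    covers   : ∀ u v → Adj G u v →
                 Σ (Fin copies) λ c → Σ (Fin (nE H)) λ e → φ c ↦ end H e ≈ (u , v)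
    disjoint : ∀ u v → Adj G u v → ∀ c e c′ e′ →
                 φ c ↦ end H e ≈ (u , v) → φ c′ ↦ end H e′ ≈ (u , v) →
                 (c ≡ c′) × (e ≡ e′)

module Submission where

-- View Q_{2n} as the Cartesian product Q_n □ Q_n: horizontal edges lie in a layer Q_n × {x},
-- vertical edges in a fibre {u} × Q_n.  For every cycle c of the given decomposition and
-- every layer x, the copy indexed by (c , x) is c placed in layer x, with a pendant edge at
-- each cycle vertex c(i) going vertically in the direction of the cycle edge that leaves
-- c(i) forwards if x has even weight and backwards if x has odd weight.  Horizontal edges are
-- covered exactly once because the cycles decompose every layer.  A vertical edge
-- {(u , w) , (u , w + e_t)} joins an even and an odd layer, while the edge {u , u + e_t} of
-- Q_n lies on exactly one cycle and is traversed from u either forwards or backwards; this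
-- selects exactly one of the two layers whose pendant at u is the given vertical edge.

open import Defs
open import Data.Bool using (Bool; true; false; not; _xor_)
open import Data.Bool.Properties
  using (not-¬; ¬-not; not-involutive; not-distribˡ-xor; not-distribʳ-xor)
  renaming (_≟_ to _≟ᵇ_)
open import Data.Empty using (⊥)
open import Data.Fin using (Fin; zero; suc; toℕ; fromℕ; inject₁; _↑ˡ_; _↑ʳ_; splitAt; join)
open import Data.Fin.Properties
  using (toℕ-injective; toℕ-fromℕ<; toℕ-fromℕ; toℕ-inject₁; toℕ<n; splitAt-join;
         splitAt⁻¹-↑ˡ; splitAt⁻¹-↑ʳ; 2↔Bool; *↔×; +↔⊎; _≟_)
open import Data.Fin.Relation.Unary.Top using (view; ‵fromℕ; ‵inj₁)
open import Data.Nat using (ℕ; zero; suc; _+_; _*_; _^_; _%_; _≤_; s≤s)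
open import Data.Nat.DivMod using (n%n≡0; m<n⇒m%n≡m)
open import Data.Nat.Properties using (+-identityʳ)
open import Data.Product using (Σ; ∃-syntax; _×_; _,_; proj₁; proj₂; uncurry)
open import Data.Product.Function.NonDependent.Propositional using (_×-↔_)
open import Data.Sum using (_⊎_; inj₁; inj₂)
open import Data.Vec using (Vec; []; _∷_; lookup; updateAt; _++_; take; drop; tabulate; uncons)
open import Data.Vec.Properties
  using (lookup∘updateAt; lookup∘updateAt′; updateAt-updateAt; updateAt-cong; updateAt-id;
         tabulate∘lookup; tabulate-cong; take++drop≡id; ++-injectiveˡ; ++-injectiveʳ)
open import Function using (_∘_; id; _↔_; Inverse; mk↔ₛ′; Injection)
open import Function.Definitions using (Injective)
open import Function.Properties.Inverse using (↔-refl; ↔-sym; ↔-trans; ↔⇒↣)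
open import Relation.Binary.PropositionalEquality
  using (_≡_; _≢_; _≗_; refl; sym; trans; cong; cong₂; subst; subst₂; module ≡-Reasoning)
open import Relation.Nullary using (yes; no; contradiction)

open ≡-Reasoning

infix  4 _≐_ _≅_
infixr 6 _□_

_≐_ : {A : Set} → A × A → A × A → Set
p ≐ q = id ↦ p ≈ q

↦-map : {A B C : Set} (g : B → C) {φ : A → B} {e : A × A} {u v : B} →
        φ ↦ e ≈ (u , v) → (g ∘ φ) ↦ e ≈ (g u , g v)
↦-map g (inj₁ (p , q)) = inj₁ (cong g p , cong g q)
↦-map g (inj₂ (p , q)) = inj₂ (cong g p , cong g q)

↦-cong : {A B : Set} {φ ψ : A → B} {e : A × A} {q : B × B} → φ ≗ ψ → φ ↦ e ≈ q → ψ ↦ e ≈ q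
↦-cong φ≗ψ (inj₁ (p , q)) = inj₁ (trans (sym (φ≗ψ _)) p , trans (sym (φ≗ψ _)) q)
↦-cong φ≗ψ (inj₂ (p , q)) = inj₂ (trans (sym (φ≗ψ _)) p , trans (sym (φ≗ψ _)) q)

≐-diagonal : {A : Set} {a u v : A} → (a , a) ≐ (u , v) → a ≡ u × a ≡ v
≐-diagonal (inj₁ (p , q)) = p , q
≐-diagonal (inj₂ (p , q)) = q , p

-- Bit flips and parity

flipAt : ∀ {d} → Vec Bool d → Fin d → Vec Bool d
flipAt v i = updateAt v i not

flipAt-involutive : ∀ {d} (v : Vec Bool d) i → flipAt (flipAt v i) i ≡ v
flipAt-involutive v i = begin
  updateAt (updateAt v i not) i not  ≡⟨ updateAt-updateAt i v ⟩
  updateAt v i (not ∘ not)           ≡⟨ updateAt-cong i not-involutive v ⟩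
  updateAt v i id                    ≡⟨ updateAt-id i v ⟩
  v                                  ∎

flipAt-sym : ∀ {d} {u v : Vec Bool d} {i} → v ≡ flipAt u i → u ≡ flipAt v i
flipAt-sym {u = u} {i = i} refl = sym (flipAt-involutive u i)

flipAt-≢ : ∀ {d} (v : Vec Bool d) i → flipAt v i ≢ v
flipAt-≢ v i flipAt≡v =
  not-¬ refl (trans (cong (λ w → lookup w i) (sym flipAt≡v)) (lookup∘updateAt i v))

flipAt-injectiveʳ : ∀ {d} (v : Vec Bool d) {i j} → flipAt v i ≡ flipAt v j → i ≡ j
flipAt-injectiveʳ v {i} {j} same with i ≟ j
... | yes i≡j = i≡j
... | no  i≢j = contradiction lookup-flipped (not-¬ refl)
  where
  lookup-flipped : lookup v i ≡ not (lookup v i)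
  lookup-flipped = begin
    lookup v i             ≡⟨ lookup∘updateAt′ i j i≢j v ⟨
    lookup (flipAt v j) i  ≡⟨ cong (λ w → lookup w i) same ⟨
    lookup (flipAt v i) i  ≡⟨ lookup∘updateAt i v ⟩
    not (lookup v i)       ∎

flipAt-++ˡ : ∀ {a b} (u : Vec Bool a) (w : Vec Bool b) t →
             flipAt (u ++ w) (t ↑ˡ b) ≡ flipAt u t ++ w
flipAt-++ˡ (x ∷ u) w zero    = refl
flipAt-++ˡ (x ∷ u) w (suc t) = cong (x ∷_) (flipAt-++ˡ u w t)

flipAt-++ʳ : ∀ {a b} (u : Vec Bool a) (w : Vec Bool b) t →
             flipAt (u ++ w) (a ↑ʳ t) ≡ u ++ flipAt w t
flipAt-++ʳ []      w t = refl
flipAt-++ʳ (x ∷ u) w t = cong (x ∷_) (flipAt-++ʳ u w t)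

flipAt-edge-ends : ∀ {d} {x w w′ : Vec Bool d} {t} →
                   (x , flipAt x t) ≐ (w , w′) → w′ ≡ flipAt w t × (x ≡ w ⊎ x ≡ flipAt w t)
flipAt-edge-ends                 (inj₁ (refl , refl)) = refl , inj₁ refl
flipAt-edge-ends {x = x} {t = t} (inj₂ (refl , refl)) =
  sym (flipAt-involutive x t) , inj₂ (sym (flipAt-involutive x t))

flipAt-edge-not-diagonal : ∀ {d} {x x′ w w′ : Vec Bool d} {t} →
                           (x , x) ≐ (w , w′) → (x′ , flipAt x′ t) ≐ (w , w′) → ⊥
flipAt-edge-not-diagonal {w = w} {t = t} diagonal edge =
  flipAt-≢ w t (trans (sym (proj₁ (flipAt-edge-ends edge))) (trans (sym x≡w′) x≡w))
  where
  x≡w  = proj₁ (≐-diagonal diagonal)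
  x≡w′ = proj₂ (≐-diagonal diagonal)

parity : ∀ {d} → Vec Bool d → Bool
parity []       = false
parity (x ∷ xs) = x xor parity xs

parity-flipAt : ∀ {d} (v : Vec Bool d) i → parity (flipAt v i) ≡ not (parity v)
parity-flipAt (x ∷ xs) zero    = sym (not-distribˡ-xor x (parity xs))
parity-flipAt (x ∷ xs) (suc i) =
  trans (cong (x xor_) (parity-flipAt xs i)) (sym (not-distribʳ-xor x (parity xs)))

parity-injective-on-edge : ∀ {d} {w x x′ : Vec Bool d} {t} →
                           x ≡ w ⊎ x ≡ flipAt w t → x′ ≡ w ⊎ x′ ≡ flipAt w t →
                           parity x ≡ parity x′ → x ≡ x′
parity-injective-on-edge                 (inj₁ refl) (inj₁ refl) _    = refl
parity-injective-on-edge {w = w} {t = t} (inj₁ refl) (inj₂ refl) same =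
  contradiction (trans same (parity-flipAt w t)) (not-¬ refl)
parity-injective-on-edge {w = w} {t = t} (inj₂ refl) (inj₁ refl) same =
  contradiction (trans (sym same) (parity-flipAt w t)) (not-¬ refl)
parity-injective-on-edge                 (inj₂ refl) (inj₂ refl) _    = refl

flipAt-edge-end-of-parity : ∀ {d} (w : Vec Bool d) t b →
                            ∃[ x ] parity x ≡ b × (x , flipAt x t) ≐ (w , flipAt w t)
flipAt-edge-end-of-parity w t b with parity w ≟ᵇ b
... | yes w-has-b = w , w-has-b , inj₁ (refl , refl)
... | no  w-lacks-b =
  flipAt w t , trans (parity-flipAt w t) (sym (¬-not (w-lacks-b ∘ sym))) ,
  inj₂ (refl , flipAt-involutive w t)

-- Hypercubes and products

Q′ : ℕ → Graph
Q′ d = record { V = Vec Bool d ; Adj = λ u v → ∃[ i ] v ≡ flipAt u i }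

Q′-sym : ∀ {d} {u v : Vec Bool d} → Adj (Q′ d) u v → Adj (Q′ d) v u
Q′-sym (i , v≡) = i , flipAt-sym v≡

_□_ : Graph → Graph → Graph
G □ H = record
  { V   = V G × V H
  ; Adj = λ { (u , w) (u′ , w′) → (Adj G u u′ × w ≡ w′) ⊎ (u ≡ u′ × Adj H w w′) } }

record _≅_ (G H : Graph) : Set where
  field
    vertices : V G ↔ V H
  open Inverse vertices public
  field
    to-adj   : ∀ {x y} → Adj G x y → Adj H (to x) (to y)
    from-adj : ∀ {x y} → Adj H x y → Adj G (from x) (from y)

≅-sym : ∀ {G H} → G ≅ H → H ≅ G
≅-sym G≅H = record { vertices = ↔-sym vertices ; to-adj = from-adj ; from-adj = to-adj }
  where open _≅_ G≅H

Q≅Q′ : ∀ d → Q d ≅ Q′ d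
Q≅Q′ d = record { vertices = ↔-refl ; to-adj = differ⇒flipAt ; from-adj = flipAt⇒differ }
  where
  lookup-ext : {u v : Vec Bool d} → (∀ j → lookup u j ≡ lookup v j) → u ≡ v
  lookup-ext {u} {v} same = begin
    u                    ≡⟨ tabulate∘lookup u ⟨
    tabulate (lookup u)  ≡⟨ tabulate-cong same ⟩
    tabulate (lookup v)  ≡⟨ tabulate∘lookup v ⟩
    v                    ∎

  differ⇒flipAt : ∀ {u v} → Adj (Q d) u v → Adj (Q′ d) u v
  differ⇒flipAt {u} {v} (i , differ , agree) = i , lookup-ext pointwise
    where
    pointwise : ∀ j → lookup v j ≡ lookup (flipAt u i) j
    pointwise j with j ≟ i
    ... | yes refl = trans (¬-not (differ ∘ sym)) (sym (lookup∘updateAt i u))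
    ... | no  j≢i  = trans (sym (agree j j≢i)) (sym (lookup∘updateAt′ j i j≢i u))

  flipAt⇒differ : ∀ {u v} → Adj (Q′ d) u v → Adj (Q d) u v
  flipAt⇒differ {u} (i , refl) =
    i , (λ same → not-¬ refl (trans same (lookup∘updateAt i u))) ,
    λ j j≢i → sym (lookup∘updateAt′ j i j≢i u)

Q′□Q′≅Q′ : ∀ a b → Q′ a □ Q′ b ≅ Q′ (a + b)
Q′□Q′≅Q′ a b = record
  { vertices = mk↔ₛ′ (uncurry _++_) split (take++drop≡id a) split-++
  ; to-adj   = ++-adj
  ; from-adj = split-adj }
  where
  split : Vec Bool (a + b) → Vec Bool a × Vec Bool b
  split v = take a v , drop a v

  split-++ : ∀ ((u , w) : Vec Bool a × Vec Bool b) → split (u ++ w) ≡ (u , w)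
  split-++ (u , w) = cong₂ _,_ (++-injectiveˡ _ u split-id) (++-injectiveʳ _ u split-id)
    where split-id = take++drop≡id a (u ++ w)

  ++-adj : ∀ {x y} → Adj (Q′ a □ Q′ b) x y → Adj (Q′ (a + b)) (uncurry _++_ x) (uncurry _++_ y)
  ++-adj {u , w} (inj₁ ((t , refl) , refl)) = t ↑ˡ b , sym (flipAt-++ˡ u w t)
  ++-adj {u , w} (inj₂ (refl , t , refl))    = a ↑ʳ t , sym (flipAt-++ʳ u w t)

  split-++-adj : ∀ u w i → Adj (Q′ a □ Q′ b) (split (u ++ w)) (split (flipAt (u ++ w) i))
  split-++-adj u w i with splitAt a i in i-half
  ... | inj₁ t with refl ← splitAt⁻¹-↑ˡ i-half =
    subst₂ (Adj (Q′ a □ Q′ b)) (sym (split-++ (u , w)))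
      (sym (trans (cong split (flipAt-++ˡ u w t)) (split-++ (flipAt u t , w))))
      (inj₁ ((t , refl) , refl))
  ... | inj₂ t with refl ← splitAt⁻¹-↑ʳ i-half =
    subst₂ (Adj (Q′ a □ Q′ b)) (sym (split-++ (u , w)))
      (sym (trans (cong split (flipAt-++ʳ u w t)) (split-++ (u , flipAt w t))))
      (inj₂ (refl , t , refl))

  split-adj : ∀ {x y} → Adj (Q′ (a + b)) x y → Adj (Q′ a □ Q′ b) (split x) (split y)
  split-adj {x} (i , refl) =
    subst (λ x → Adj (Q′ a □ Q′ b) (split x) (split (flipAt x i)))
      (take++drop≡id a x) (split-++-adj (take a x) (drop a x) i)

-- Decompositions with copies indexed by an arbitrary type

record IndexedDecomposition (I : Set) (H : Pattern) (G : Graph) : Set where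
  field
    φ        : I → PV H → V G
    injφ     : ∀ c → Injective _≡_ _≡_ (φ c)
    edges    : ∀ c e → Adj G (φ c (proj₁ (end H e))) (φ c (proj₂ (end H e)))
    covers   : ∀ u v → Adj G u v →
                 Σ I λ c → Σ (Fin (nE H)) λ e → φ c ↦ end H e ≈ (u , v)
    disjoint : ∀ u v → Adj G u v → ∀ c e c′ e′ →
                 φ c ↦ end H e ≈ (u , v) → φ c′ ↦ end H e′ ≈ (u , v) →
                 (c ≡ c′) × (e ≡ e′)

indexed : ∀ {H G} (D : Decomposition H G) →
          IndexedDecomposition (Fin (Decomposition.copies D)) H G
indexed D = record { φ = φ ; injφ = injφ ; edges = edges ; covers = covers ; disjoint = disjoint }
  where open Decomposition D

toDecomposition : ∀ {I H G N} → Fin N ↔ I → IndexedDecomposition I H G → Decomposition H G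
toDecomposition {H = H} {N = N} Fin↔I D = record
  { copies   = N
  ; φ        = φ ∘ to
  ; injφ     = injφ ∘ to
  ; edges    = edges ∘ to
  ; covers   = λ u v uv →
      let c , e , image = covers u v uv in
      from c , e , subst (λ c → φ c ↦ end H e ≈ (u , v)) (sym (strictlyInverseˡ c)) image
  ; disjoint = λ u v uv c e c′ e′ image image′ →
      let same-copy , same-edge = disjoint u v uv (to c) e (to c′) e′ image image′ in
      Injection.injective (↔⇒↣ Fin↔I) same-copy , same-edge }
  where
  open IndexedDecomposition D
  open Inverse Fin↔I

transport : ∀ {I H G G′} → G ≅ G′ → IndexedDecomposition I H G → IndexedDecomposition I H G′
transport {H = H} G≅G′ D = record
  { φ        = λ c → to ∘ φ c
  ; injφ     = λ c → injφ c ∘ Injection.injective (↔⇒↣ vertices)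
  ; edges    = λ c e → to-adj (edges c e)
  ; covers   = λ u v uv →
      let c , e , image = covers (from u) (from v) (from-adj uv) in
      c , e , subst₂ (λ u v → (to ∘ φ c) ↦ end H e ≈ (u , v))
                (strictlyInverseˡ u) (strictlyInverseˡ v) (↦-map to {φ c} {end H e} image)
  ; disjoint = λ u v uv c e c′ e′ image image′ →
      disjoint (from u) (from v) (from-adj uv) c e c′ e′ (pull image) (pull image′) }
  where
  open _≅_ G≅G′
  open IndexedDecomposition D

  pull : ∀ {c e u v} → (to ∘ φ c) ↦ e ≈ (u , v) → φ c ↦ e ≈ (from u , from v)
  pull {c} {e} image =
    ↦-cong {e = e} (strictlyInverseʳ ∘ φ c) (↦-map from {to ∘ φ c} {e} image)

∷↔× : ∀ {A : Set} {n} → Vec A (suc n) ↔ (A × Vec A n)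
∷↔× = mk↔ₛ′ uncons (uncurry _∷_) (λ _ → refl) λ { (x ∷ xs) → refl }

Vec-Bool↔Fin : ∀ n → Vec Bool n ↔ Fin (2 ^ n)
Vec-Bool↔Fin zero    = mk↔ₛ′ (λ _ → zero) (λ _ → []) (λ { zero → refl }) (λ { [] → refl })
Vec-Bool↔Fin (suc n) = ↔-trans ∷↔× (↔-trans (↔-sym 2↔Bool ×-↔ Vec-Bool↔Fin n) (↔-sym *↔×))

-- Cycles and the sunlet copies

prev : ∀ {k} → Fin k → Fin k
prev {suc k} zero    = fromℕ k
prev {suc k} (suc i) = inject₁ i

next-fromℕ : ∀ k → next (fromℕ k) ≡ zero
next-fromℕ k = toℕ-injective (begin
  toℕ (next (fromℕ k))         ≡⟨ toℕ-fromℕ< _ ⟩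
  suc (toℕ (fromℕ k)) % suc k  ≡⟨ cong (λ m → suc m % suc k) (toℕ-fromℕ k) ⟩
  suc k % suc k                ≡⟨ n%n≡0 (suc k) ⟩
  0                            ∎)

next-inject₁ : ∀ {k} (j : Fin k) → next (inject₁ j) ≡ suc j
next-inject₁ {k} j = toℕ-injective (begin
  toℕ (next (inject₁ j))         ≡⟨ toℕ-fromℕ< _ ⟩
  suc (toℕ (inject₁ j)) % suc k  ≡⟨ cong (λ m → suc m % suc k) (toℕ-inject₁ j) ⟩
  suc (toℕ j) % suc k            ≡⟨ m<n⇒m%n≡m (s≤s (toℕ<n j)) ⟩
  suc (toℕ j)                    ∎)

next-prev : ∀ {k} (i : Fin k) → next (prev i) ≡ i
next-prev {suc k} zero    = next-fromℕ k
next-prev {suc k} (suc i) = next-inject₁ i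

prev-next : ∀ {k} (i : Fin k) → prev (next i) ≡ i
prev-next {suc k} i with view i
... | ‵fromℕ          rewrite next-fromℕ k   = refl
... | ‵inj₁ {i = j} _ rewrite next-inject₁ j = refl

-- A dart of C_k is a vertex i with a direction b, forwards (false) or backwards (true);
-- it runs from i to step b i along the cycle edge dartEdge b i.

step : ∀ {k} → Bool → Fin k → Fin k
step false = next
step true  = prev

dartEdge : ∀ {k} → Bool → Fin k → Fin k
dartEdge false i = i
dartEdge true  i = prev i

sunletEnds : ∀ {k} → Fin k ⊎ Fin k → (Fin k ⊎ Fin k) × (Fin k ⊎ Fin k)
sunletEnds (inj₁ i) = inj₁ i , inj₁ (next i)
sunletEnds (inj₂ i) = inj₁ i , inj₂ i

end-L : ∀ k e → end (L k) e ≡ sunletEnds (splitAt k e)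
end-L k e with splitAt k e
... | inj₁ i = refl
... | inj₂ i = refl

module Sunlets {I : Set} {n k : ℕ} (D : IndexedDecomposition I (C k) (Q′ n)) where
  open IndexedDecomposition D

  cycle-edge-adjacent : ∀ {c i u v} → φ c ↦ (i , next i) ≈ (u , v) → Adj (Q′ n) u v
  cycle-edge-adjacent {c} {i} (inj₁ (refl , refl)) = edges c i
  cycle-edge-adjacent {c} {i} (inj₂ (refl , refl)) = Q′-sym (edges c i)

  φ-next-≢ : ∀ c i → φ c (next i) ≢ φ c i
  φ-next-≢ c i same = flipAt-≢ (φ c i) t (trans (sym next≡flipAt) same)
    where
    t = proj₁ (edges c i)
    next≡flipAt = proj₂ (edges c i)

  dart-edge : ∀ c i b → φ c ↦ end (C k) (dartEdge b i) ≈ (φ c i , φ c (step b i))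
  dart-edge c i false = inj₁ (refl , refl)
  dart-edge c i true  = inj₂ (refl , cong (φ c) (next-prev i))

  dart-adjacent : ∀ c i b → Adj (Q′ n) (φ c i) (φ c (step b i))
  dart-adjacent c i b = cycle-edge-adjacent (dart-edge c i b)

  dartDir : I → Fin k → Bool → Fin n
  dartDir c i b = proj₁ (dart-adjacent c i b)

  dartDir-unique : ∀ {c i b u t} → φ c i ≡ u → φ c (step b i) ≡ flipAt u t → dartDir c i b ≡ t
  dartDir-unique {c} {i} {b} refl head =
    flipAt-injectiveʳ (φ c i) (trans (sym (proj₂ (dart-adjacent c i b))) head)

  dartEdge-injective : ∀ c i {b b′} → dartEdge b i ≡ dartEdge b′ i → b ≡ b′
  dartEdge-injective c i {false} {false} _ = refl
  dartEdge-injective c i {true}  {true}  _ = refl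
  dartEdge-injective c i {false} {true}  i≡prev =
    contradiction (cong (φ c) (trans (cong next i≡prev) (next-prev i))) (φ-next-≢ c i)
  dartEdge-injective c i {true}  {false} prev≡i =
    contradiction (cong (φ c) (trans (cong next (sym prev≡i)) (next-prev i))) (φ-next-≢ c i)

  darts-unique : ∀ {c c′ i i′ b b′} → φ c i ≡ φ c′ i′ → φ c (step b i) ≡ φ c′ (step b′ i′) →
                 c ≡ c′ × i ≡ i′ × b ≡ b′
  darts-unique {c} {c′} {i} {i′} {b} {b′} same-tail same-head
    with refl , same-edge ← disjoint _ _ (dart-adjacent c i b) c (dartEdge b i) c′ (dartEdge b′ i′)
                              (dart-edge c i b)
                              (subst₂ (λ u v → φ c′ ↦ end (C k) (dartEdge b′ i′) ≈ (u , v))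
                                 (sym same-tail) (sym same-head) (dart-edge c′ i′ b′))
    with refl ← injφ c same-tail
    = refl , refl , dartEdge-injective c i same-edge

  dart-covered : ∀ u t → ∃[ c ] ∃[ i ] ∃[ b ] φ c i ≡ u × φ c (step b i) ≡ flipAt u t
  dart-covered u t with covers u (flipAt u t) (t , refl)
  ... | c , e , inj₁ (tail , head) = c , e , false , tail , head
  ... | c , e , inj₂ (head , tail) = c , next e , true , tail , trans (cong (φ c) (prev-next e)) head

  pendantDir : I → Vec Bool n → Fin k → Fin n
  pendantDir c x i = dartDir c i (parity x)

  sunlet : I × Vec Bool n → Fin k ⊎ Fin k → Vec Bool n × Vec Bool n
  sunlet (c , x) (inj₁ i) = φ c i , x
  sunlet (c , x) (inj₂ i) = φ c i , flipAt x (pendantDir c x i)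

  sunlet-injective : ∀ p → Injective _≡_ _≡_ (sunlet p)
  sunlet-injective (c , x) {inj₁ i} {inj₁ j} same = cong inj₁ (injφ c (cong proj₁ same))
  sunlet-injective (c , x) {inj₁ i} {inj₂ j} same = contradiction (sym (cong proj₂ same)) (flipAt-≢ x _)
  sunlet-injective (c , x) {inj₂ i} {inj₁ j} same = contradiction (cong proj₂ same) (flipAt-≢ x _)
  sunlet-injective (c , x) {inj₂ i} {inj₂ j} same = cong inj₂ (injφ c (cong proj₁ same))

  sunlet-edges : ∀ p s → Adj (Q′ n □ Q′ n) (sunlet p (proj₁ (sunletEnds s)))
                                           (sunlet p (proj₂ (sunletEnds s)))
  sunlet-edges (c , x) (inj₁ i) = inj₁ (edges c i , refl)
  sunlet-edges (c , x) (inj₂ i) = inj₂ (refl , pendantDir c x i , refl)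

  sunlet-covers : ∀ u v → Adj (Q′ n □ Q′ n) u v → ∃[ p ] ∃[ s ] sunlet p ↦ sunletEnds s ≈ (u , v)
  sunlet-covers (u , w) _ (inj₁ ((t , refl) , refl)) =
    let c , e , image = covers u (flipAt u t) (t , refl) in
    (c , w) , inj₁ e , ↦-map (_, w) {φ c} {e , next e} image
  sunlet-covers (u , w) _ (inj₂ (refl , t , refl)) =
    let c , i , b , tail , head = dart-covered u t
        x , x-has-b , layer     = flipAt-edge-end-of-parity w t b
        dir≡t : pendantDir c x i ≡ t
        dir≡t = trans (cong (dartDir c i) x-has-b) (dartDir-unique {b = b} tail head)
    in (c , x) , inj₂ i ,
       subst₂ (λ y t′ → ((φ c i , x) , (φ c i , flipAt x t′)) ≐ ((y , w) , (y , flipAt w t)))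
         tail (sym dir≡t) (↦-map (φ c i ,_) {id} {x , flipAt x t} layer)

  pendants-disjoint : ∀ {c x i c′ x′ i′ u w w′} → φ c i ≡ u → φ c′ i′ ≡ u →
                      (x , flipAt x (pendantDir c x i)) ≐ (w , w′) →
                      (x′ , flipAt x′ (pendantDir c′ x′ i′)) ≐ (w , w′) →
                      (c , x) ≡ (c′ , x′) × i ≡ i′
  pendants-disjoint {c} {x} {i} {c′} {x′} {i′} {w = w} refl same-tail edge edge′
    with w′≡ , x-end ← flipAt-edge-ends edge
    with w′≡′ , x′-end ← flipAt-edge-ends edge′
    with same-dir ← flipAt-injectiveʳ w (trans (sym w′≡) w′≡′)
    with refl , refl , same-parity ←
           darts-unique {b = parity x} {b′ = parity x′} (sym same-tail) (begin
      φ c (step (parity x) i)                 ≡⟨ proj₂ (dart-adjacent c i (parity x)) ⟩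
      flipAt (φ c i) (pendantDir c x i)       ≡⟨ cong₂ flipAt (sym same-tail) same-dir ⟩
      flipAt (φ c′ i′) (pendantDir c′ x′ i′)  ≡⟨ proj₂ (dart-adjacent c′ i′ (parity x′)) ⟨
      φ c′ (step (parity x′) i′)              ∎)
    = cong (c ,_) (parity-injective-on-edge x-end x′-end′ same-parity) , refl
    where x′-end′ = subst (λ t → x′ ≡ w ⊎ x′ ≡ flipAt w t) (sym same-dir) x′-end

  base-image : ∀ p s {u v} → sunlet p ↦ sunletEnds s ≈ (u , v) →
               (proj₁ ∘ sunlet p) ↦ sunletEnds s ≈ (proj₁ u , proj₁ v)
  base-image p s = ↦-map proj₁ {sunlet p} {sunletEnds s}

  layer-image : ∀ p s {u v} → sunlet p ↦ sunletEnds s ≈ (u , v) →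
                (proj₂ ∘ sunlet p) ↦ sunletEnds s ≈ (proj₂ u , proj₂ v)
  layer-image p s = ↦-map proj₂ {sunlet p} {sunletEnds s}

  sunlet-disjoint : ∀ {u v} p s p′ s′ →
                    sunlet p ↦ sunletEnds s ≈ (u , v) → sunlet p′ ↦ sunletEnds s′ ≈ (u , v) →
                    p ≡ p′ × s ≡ s′
  sunlet-disjoint p@(c , x) s@(inj₁ i) p′@(c′ , x′) s′@(inj₁ i′) image image′ =
    cong₂ _,_ (proj₁ same-edge) (trans x≡w (sym x′≡w)) , cong inj₁ (proj₂ same-edge)
    where
    base      = base-image p s image
    x≡w       = proj₁ (≐-diagonal (layer-image p s image))
    x′≡w      = proj₁ (≐-diagonal (layer-image p′ s′ image′))
    same-edge = disjoint _ _ (cycle-edge-adjacent base) c i c′ i′ base (base-image p′ s′ image′)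
  sunlet-disjoint p s@(inj₁ _) p′ s′@(inj₂ _) image image′ =
    contradiction (layer-image p′ s′ image′) (flipAt-edge-not-diagonal (layer-image p s image))
  sunlet-disjoint p s@(inj₂ _) p′ s′@(inj₁ _) image image′ =
    contradiction (layer-image p s image) (flipAt-edge-not-diagonal (layer-image p′ s′ image′))
  sunlet-disjoint p s@(inj₂ _) p′ s′@(inj₂ _) image image′ =
    proj₁ same-pendant , cong inj₂ (proj₂ same-pendant)
    where
    same-pendant = pendants-disjoint (proj₁ (≐-diagonal (base-image p s image)))
                                     (proj₁ (≐-diagonal (base-image p′ s′ image′)))
                                     (layer-image p s image) (layer-image p′ s′ image′)

  sunletDecomposition : IndexedDecomposition (I × Vec Bool n) (L k) (Q′ n □ Q′ n)
  sunletDecomposition = record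
    { φ        = sunlet
    ; injφ     = sunlet-injective
    ; edges    = λ p e → subst (λ (a , b) → Adj (Q′ n □ Q′ n) (sunlet p a) (sunlet p b))
                           (sym (end-L k e)) (sunlet-edges p (splitAt k e))
    ; covers   = λ u v uv →
        let p , s , image = sunlet-covers u v uv in
        p , join k k s , subst (λ ends → sunlet p ↦ ends ≈ (u , v)) (sym (end-L-join s)) image
    ; disjoint = λ u v _ p e p′ e′ image image′ →
        let same-copy , same-half =
              sunlet-disjoint p (splitAt k e) p′ (splitAt k e′)
                (subst (λ ends → sunlet p ↦ ends ≈ (u , v)) (end-L k e) image)
                (subst (λ ends → sunlet p′ ↦ ends ≈ (u , v)) (end-L k e′) image′)
        in same-copy , Injection.injective (↔⇒↣ +↔⊎) same-half }
    where
    end-L-join : ∀ s → end (L k) (join k k s) ≡ sunletEnds s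
    end-L-join s = trans (end-L k (join k k s)) (cong sunletEnds (splitAt-join k k s))

open Sunlets using (sunletDecomposition)

lemma12 : (n k : ℕ) → 1 ≤ n → 3 ≤ k →
          Decomposition (C k) (Q n) → Decomposition (L k) (Q (2 * n))
lemma12 n k _ _ D =
  subst (Decomposition (L k) ∘ Q) (sym (cong (n +_) (+-identityʳ n)))
    (toDecomposition (↔-trans *↔× (↔-refl ×-↔ ↔-sym (Vec-Bool↔Fin n)))
      (transport (≅-sym (Q≅Q′ (n + n)))
        (transport (Q′□Q′≅Q′ n n)
          (sunletDecomposition (transport (Q≅Q′ n) (indexed D))))))
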